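{- Let $\mathsf{Ax}$ be the following set of unfolding axioms over the finite set of agents $\mathbb{A}$ preordered by $\sqsubseteq$: $\mathcal{B}_a\Rrightarrow\mathcal{B}_a\cdot\mathcal{B}_a$; $\mathcal{I}_{a\leftarrow b}\Rrightarrow\mathcal{B}_a\cdot\mathcal{I}_{a\leftarrow b}$; $\mathcal{I}_{a\leftarrow b}\Rrightarrow\mathcal{I}_{a\leftarrow b}\cdot\mathcal{B}_b$; $\mathcal{B}_a\Rrightarrow\mathcal{B}_b$ whenever $a\sqsubseteq b$; $\mathcal{I}_{a\leftarrow c}\Rrightarrow\mathcal{I}_{b\leftarrow c}$ and $\mathcal{I}_{c\leftarrow a}\Rrightarrow\mathcal{I}_{c\leftarrow b}$ whenever $a\sqsubseteq b$; $\Box\Rrightarrow\mathcal{M}\cdot\Box$ for every modality $\mathcal{M}$; and $\Box\Rrightarrow\varepsilon$ (for all $a,b,c\in\mathbb{A}$). Then the reflexive and transitive closure $\widehat{\mathsf{Ax}}$ is decomposable.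
   Context: The modalities are $\mathcal{B}_a$ ($a\in\mathbb{A}$), $\mathcal{I}_{a\leftarrow b}$ ($a,b\in\mathbb{A}$) and $\Box$, where $\mathbb{A}$ is a finite set of agents with a preorder $\sqsubseteq$. A modal unfolding axiom is a pair $(\mathcal{M}\Rrightarrow l)$ with $\mathcal{M}$ a modality and $l$ a finite (possibly empty, denoted $\varepsilon$) list of modalities, read as the axiom scheme $\mathcal{M}A\Rightarrow l(A)$ where $\varepsilon(A)=A$, $(\mathcal{N}\cdot l)(A)=\mathcal{N}(l(A))$. The reflexive and transitive closure $\widehat{\mathsf{Ax}}$ is the smallest set containing $\mathsf{Ax}$, containing $\mathcal{M}\Rrightarrow\mathcal{M}$ for every modality, and such that whenever $\mathcal{M}\Rrightarrow l\cdot\mathcal{N}\cdot l'$ and $\mathcal{N}\Rrightarrow r$ are in it, so is $\mathcal{M}\Rrightarrow l\cdot r\cdot l'$. A set $X$ of unfolding axioms is decomposable if whenever $\mathcal{M}\Rrightarrow\mathcal{N}\cdot\mathcal{N}'\cdot l\in X$ (a list of length at least two starting with $\mathcal{N}$) there is a modality $\mathcal{R}$ such that $\mathcal{M}\Rrightarrow\mathcal{N}\cdot\mathcal{R}\in X$ and, for every $\mathcal{M}\Rrightarrow\mathcal{N}\cdot\mathcal{T}\cdot r\in X$, also $\mathcal{R}\Rrightarrow\mathcal{T}\cdot r\in X$. -}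

module Defs where

open import Level using (0ℓ)
open import Data.Nat using (ℕ)
open import Data.Fin using (Fin)
open import Data.List using (List; []; _∷_; _++_; [_])
open import Data.Product using (Σ; _×_; _,_)
open import Relation.Binary.Core using (Rel)
open import Relation.Binary.PropositionalEquality using (_≡_)

data Modality (Ag : Set) : Set where
  B   : Ag → Modality Ag
  I   : Ag → Ag → Modality Ag     -- 𝓘_{a←b} written I a b
  box : Modality Ag

AxSet : Set → Set₁
AxSet Ag = Modality Ag → List (Modality Ag) → Set

data Closure {Ag : Set} (Ax : AxSet Ag) : AxSet Ag where
  base  : ∀ {M l} → Ax M l → Closure Ax M l
  refl⇛ : ∀ M → Closure Ax M [ M ]
  trans⇛ : ∀ {M N} l l' r → Closure Ax M (l ++ N ∷ l') → Closure Ax N r →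
           Closure Ax M (l ++ r ++ l')

Decomposable : {Ag : Set} → AxSet Ag → Set
Decomposable {Ag} X =
  ∀ M N N' l → X M (N ∷ N' ∷ l) →
  Σ (Modality Ag) λ R →
    X M (N ∷ R ∷ []) ×
    (∀ T r → X M (N ∷ T ∷ r) → X R (T ∷ r))

data Ax {n : ℕ} (_⊑_ : Rel (Fin n) 0ℓ) : AxSet (Fin n) where
  B4    : ∀ a → Ax _⊑_ (B a) (B a ∷ B a ∷ [])
  IB    : ∀ a b → Ax _⊑_ (I a b) (B a ∷ I a b ∷ [])
  IB'   : ∀ a b → Ax _⊑_ (I a b) (I a b ∷ B b ∷ [])
  Bmono : ∀ a b → a ⊑ b → Ax _⊑_ (B a) (B b ∷ [])
  Imon₁ : ∀ a b c → a ⊑ b → Ax _⊑_ (I a c) (I b c ∷ [])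
  Imon₂ : ∀ a b c → a ⊑ b → Ax _⊑_ (I c a) (I c b ∷ [])
  box-M : ∀ M → Ax _⊑_ box (M ∷ box ∷ [])
  box-T : Ax _⊑_ box []

-- The closure admits an explicit description by the shape of the unfolded list:
-- □ unfolds to every list; 𝓑_a exactly to the nonempty lists 𝓑_{c₁}⋯𝓑_{cₖ} with
-- a ⊑ cᵢ; and 𝓘_{a←b} exactly to the lists 𝓑_{c₁}⋯𝓑_{cₖ} 𝓘_{c←d} 𝓑_{e₁}⋯𝓑_{eₘ}
-- with a ⊑ cᵢ, a ⊑ c, b ⊑ d, b ⊑ eⱼ. The description contains the axioms and is
-- stable under substitution, so it bounds the closure; conversely every such list
-- is derivable. Decomposition is then read off the shapes: the middle modality 𝓡
-- is 𝓑_a for 𝓑_a, □ for □, and for 𝓘_{a←b} it is 𝓑_b or 𝓘_{a←b} according to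
-- whether the first unfolded modality is an 𝓘 or a 𝓑.
module Submission where

open import Defs
open import Level using (0ℓ)
open import Data.Nat using (ℕ)
open import Data.Fin using (Fin)
open import Data.List using (List; []; _∷_; _++_; [_])
open import Data.List.Properties using (++-identityʳ)
open import Data.List.Relation.Unary.All as All using (All; []; _∷_)
open import Data.List.Relation.Unary.All.Properties using (++⁺; ++⁻ˡ; ++⁻ʳ)
open import Data.Product using (_×_; _,_; proj₁; proj₂)
open import Data.Unit using (⊤; tt)
open import Relation.Binary.Core using (Rel)
open import Relation.Binary.Definitions using (Reflexive; Transitive)
open import Relation.Binary.Structures using (IsPreorder)
open import Relation.Binary.PropositionalEquality using (_≡_; subst)

module _ {Ag : Set} {Ax : AxSet Ag} where

  closure-head : ∀ {M N l r} → Closure Ax M (N ∷ l) → Closure Ax N r →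
                 Closure Ax M (r ++ l)
  closure-head = trans⇛ [] _ _

  closure-last : ∀ {M N} l {r} → Closure Ax M (l ++ [ N ]) → Closure Ax N r →
                 Closure Ax M (l ++ r)
  closure-last {M} l {r} h h′ =
    subst (λ t → Closure Ax M (l ++ t)) (++-identityʳ r) (trans⇛ l [] r h h′)

data NonEmpty {A : Set} : List A → Set where
  nonEmpty : ∀ {x xs} → NonEmpty (x ∷ xs)

NonEmpty-++-middle : ∀ {A : Set} (l : List A) {r} l′ → NonEmpty r → NonEmpty (l ++ r ++ l′)
NonEmpty-++-middle []      l′ nonEmpty = nonEmpty
NonEmpty-++-middle (_ ∷ _) l′ _        = nonEmpty

module Unfoldings (n : ℕ) (_⊑_ : Rel (Fin n) 0ℓ)
                  (⊑-refl : Reflexive _⊑_) (⊑-trans : Transitive _⊑_) where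

  Mod : Set
  Mod = Modality (Fin n)

  _⇛_ : Mod → List Mod → Set
  _⇛_ = Closure (Ax _⊑_)

  data BAbove (a : Fin n) : Mod → Set where
    B≥ : ∀ {c} → a ⊑ c → BAbove a (B c)

  AllBAbove : Fin n → List Mod → Set
  AllBAbove a = All (BAbove a)

  data IUnfolding (a b : Fin n) : List Mod → Set where
    here  : ∀ {c d l} → a ⊑ c → b ⊑ d → AllBAbove b l → IUnfolding a b (I c d ∷ l)
    there : ∀ {c l} → a ⊑ c → IUnfolding a b l → IUnfolding a b (B c ∷ l)

  Unfolding : Mod → List Mod → Set
  Unfolding (B a)   l = AllBAbove a l × NonEmpty l
  Unfolding (I a b) l = IUnfolding a b l
  Unfolding box     l = ⊤

  AllBAbove-weaken : ∀ {a c l} → a ⊑ c → AllBAbove c l → AllBAbove a l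
  AllBAbove-weaken a⊑c = All.map λ { (B≥ c⊑e) → B≥ (⊑-trans a⊑c c⊑e) }

  AllBAbove-splice : ∀ {a N} l l′ {r} → AllBAbove a (l ++ N ∷ l′) → Unfolding N r →
                     AllBAbove a (l ++ r ++ l′) × NonEmpty r
  AllBAbove-splice l l′ bs u with ++⁻ʳ l bs
  ... | B≥ a⊑c ∷ bs′ =
    ++⁺ (++⁻ˡ l bs) (++⁺ (AllBAbove-weaken a⊑c (proj₁ u)) bs′) , proj₂ u

  IUnfolding-weaken : ∀ {a b c d r l} → a ⊑ c → b ⊑ d → AllBAbove b l →
                      IUnfolding c d r → IUnfolding a b (r ++ l)
  IUnfolding-weaken a⊑c b⊑d bs (here c⊑e d⊑f bs′) =
    here (⊑-trans a⊑c c⊑e) (⊑-trans b⊑d d⊑f) (++⁺ (AllBAbove-weaken b⊑d bs′) bs)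
  IUnfolding-weaken a⊑c b⊑d bs (there c⊑e u) =
    there (⊑-trans a⊑c c⊑e) (IUnfolding-weaken a⊑c b⊑d bs u)

  IUnfolding-prepend : ∀ {a b c r l} → a ⊑ c → AllBAbove c r →
                       IUnfolding a b l → IUnfolding a b (r ++ l)
  IUnfolding-prepend a⊑c []            u = u
  IUnfolding-prepend a⊑c (B≥ c⊑e ∷ bs) u = there (⊑-trans a⊑c c⊑e) (IUnfolding-prepend a⊑c bs u)

  IUnfolding-splice : ∀ {a b N} l l′ {r} → IUnfolding a b (l ++ N ∷ l′) → Unfolding N r →
                      IUnfolding a b (l ++ r ++ l′)
  IUnfolding-splice []      l′ (here a⊑c b⊑d bs) u        = IUnfolding-weaken a⊑c b⊑d bs u
  IUnfolding-splice []      l′ (there a⊑c u′)    (bs , _) = IUnfolding-prepend a⊑c bs u′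
  IUnfolding-splice (_ ∷ l) l′ (here a⊑c b⊑d bs) u        = here a⊑c b⊑d (proj₁ (AllBAbove-splice l l′ bs u))
  IUnfolding-splice (_ ∷ l) l′ (there a⊑c u′)    u        = there a⊑c (IUnfolding-splice l l′ u′ u)

  Unfolding-splice : ∀ {M N} l l′ {r} → Unfolding M (l ++ N ∷ l′) → Unfolding N r →
                     Unfolding M (l ++ r ++ l′)
  Unfolding-splice {B a}   l l′ (bs , _) u with AllBAbove-splice l l′ bs u
  ... | bs′ , r≢[] = bs′ , NonEmpty-++-middle l l′ r≢[]
  Unfolding-splice {I a b} l l′ u u′ = IUnfolding-splice l l′ u u′
  Unfolding-splice {box}   l l′ _ _  = tt

  Unfolding-refl : ∀ M → Unfolding M [ M ]
  Unfolding-refl (B a)   = B≥ ⊑-refl ∷ [] , nonEmpty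
  Unfolding-refl (I a b) = here ⊑-refl ⊑-refl []
  Unfolding-refl box     = tt

  Unfolding-axiom : ∀ {M l} → Ax _⊑_ M l → Unfolding M l
  Unfolding-axiom (B4 a)            = B≥ ⊑-refl ∷ B≥ ⊑-refl ∷ [] , nonEmpty
  Unfolding-axiom (IB a b)          = there ⊑-refl (here ⊑-refl ⊑-refl [])
  Unfolding-axiom (IB' a b)         = here ⊑-refl ⊑-refl (B≥ ⊑-refl ∷ [])
  Unfolding-axiom (Bmono a b a⊑b)   = B≥ a⊑b ∷ [] , nonEmpty
  Unfolding-axiom (Imon₁ a b c a⊑b) = here a⊑b ⊑-refl []
  Unfolding-axiom (Imon₂ a b c a⊑b) = here ⊑-refl a⊑b []
  Unfolding-axiom (box-M M)         = tt
  Unfolding-axiom box-T             = tt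

  ⇛⇒Unfolding : ∀ {M l} → M ⇛ l → Unfolding M l
  ⇛⇒Unfolding (base ax)           = Unfolding-axiom ax
  ⇛⇒Unfolding (refl⇛ M)           = Unfolding-refl M
  ⇛⇒Unfolding (trans⇛ l l′ r h h′) = Unfolding-splice l l′ (⇛⇒Unfolding h) (⇛⇒Unfolding h′)

  box⇛ : ∀ l → box ⇛ l
  box⇛ []      = base box-T
  box⇛ (M ∷ l) = closure-last [ M ] (base (box-M M)) (box⇛ l)

  B⇛ : ∀ {a} l → AllBAbove a l → NonEmpty l → B a ⇛ l
  B⇛ (B c ∷ [])    (B≥ a⊑c ∷ [])  nonEmpty = base (Bmono _ c a⊑c)
  B⇛ (B c ∷ M ∷ l) (B≥ a⊑c ∷ bs) nonEmpty =
    closure-head (closure-last [ _ ] (base (B4 _)) (B⇛ (M ∷ l) bs nonEmpty))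
                 (base (Bmono _ c a⊑c))

  I⇛I∷Bs : ∀ {a b} l → AllBAbove b l → I a b ⇛ (I a b ∷ l)
  I⇛I∷Bs []      []             = refl⇛ _
  I⇛I∷Bs (B e ∷ l) (B≥ b⊑e ∷ bs) =
    trans⇛ [ _ ] l [ B e ] (closure-head (I⇛I∷Bs l bs) (base (IB' _ _)))
                           (base (Bmono _ e b⊑e))

  I⇛ : ∀ {a b} l → IUnfolding a b l → I a b ⇛ l
  I⇛ (I c d ∷ l) (here a⊑c b⊑d bs) =
    closure-head (I⇛I∷Bs l bs)
                 (closure-head (base (Imon₁ _ c _ a⊑c)) (base (Imon₂ _ d c b⊑d)))
  I⇛ (B c ∷ l)   (there a⊑c u)     =
    closure-head (closure-last [ _ ] (base (IB _ _)) (I⇛ l u)) (base (Bmono _ c a⊑c))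

  decomposable : Decomposable _⇛_
  decomposable box N _ _ _ = box , base (box-M N) , λ T r _ → box⇛ (T ∷ r)
  decomposable (B a) N _ _ h with ⇛⇒Unfolding h
  ... | B≥ a⊑c ∷ _ , _ =
    B a , B⇛ _ (B≥ a⊑c ∷ B≥ ⊑-refl ∷ []) nonEmpty ,
    λ T r h′ → B⇛ (T ∷ r) (All.tail (proj₁ (⇛⇒Unfolding h′))) nonEmpty
  decomposable (I a b) N _ _ h with ⇛⇒Unfolding h
  ... | here a⊑c b⊑d _ =
    B b , I⇛ _ (here a⊑c b⊑d (B≥ ⊑-refl ∷ [])) ,
    λ T r h′ → tail-after-I (⇛⇒Unfolding h′)
    where
      tail-after-I : ∀ {T r} → IUnfolding a b (N ∷ T ∷ r) → B b ⇛ (T ∷ r)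
      tail-after-I (here _ _ bs) = B⇛ _ bs nonEmpty
  ... | there a⊑c _ =
    I a b , I⇛ _ (there a⊑c (here ⊑-refl ⊑-refl [])) ,
    λ T r h′ → tail-after-B (⇛⇒Unfolding h′)
    where
      tail-after-B : ∀ {T r} → IUnfolding a b (N ∷ T ∷ r) → I a b ⇛ (T ∷ r)
      tail-after-B (there _ u) = I⇛ _ u

lemma2 : (n : ℕ) (_⊑_ : Rel (Fin n) 0ℓ) → IsPreorder _≡_ _⊑_ →
         Decomposable (Closure (Ax _⊑_))
lemma2 n _⊑_ ⊑-isPreorder =
  Unfoldings.decomposable n _⊑_ (IsPreorder.refl ⊑-isPreorder) (IsPreorder.trans ⊑-isPreorder)
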